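{- Let $f(z)=Az^2+Bz+C\in\mathbb{Z}[z]$ with $A>0$, $\gcd(A,B,C)=1$ and $D=B^2-4AC$ not a perfect square, and let $\mathcal S$ be an arithmetic progression containing infinitely many primes $p$ with $\big(\frac Dp\big)=1$. Then (i) $S_a(x)=o(\pi(x))$ as $x\to\infty$ for every integer $a$ with $1\le a\le A$; (ii) $S_{\mathcal Y}(x)=o(\pi(x))$ as $x\to\infty$.
   Context: $\pi(x)$ is the prime counting function; $(\frac Dp)$ is the Legendre symbol. $\mathcal Y=\{\frac vp: p\in\mathcal S \text{ prime},\ 0\le v<p,\ f(v)\equiv0\pmod{p^2}\}$ and $S_{\mathcal Y}(x)=\#\{\frac vp\in\mathcal Y: p\le x\}$. For $1\le a\le A$, $\mathcal Y_a=\{\frac vp: p\in\mathcal S\text{ prime},\ 0\le v<p,\ f(v)=ap^2\}$ and $S_a(x)=\#\{\frac vp\in\mathcal Y_a:p\le x\}$. -}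

module Defs where

open import Data.Nat as ℕ using (ℕ; suc; _≤_)
open import Data.Nat.Primality using (Prime; prime?)
import Data.Nat.Divisibility as ℕD
open import Data.Integer as ℤ using (ℤ; +_; ∣_∣)
import Data.Integer.Properties as ℤP
open import Data.Integer.Divisibility using (_∣_)
open import Data.Product using (_×_; _,_; Σ; ∃; proj₁; proj₂)
open import Data.List using (List; length; filter; upTo; concatMap; map)
open import Relation.Nullary using (¬_; Dec; yes; no)
open import Relation.Nullary.Decidable using (_×-dec_)
open import Relation.Binary.PropositionalEquality using (_≡_; _≢_)

quad : ℤ → ℤ → ℤ → ℤ → ℤ
quad A B C z = A ℤ.* z ℤ.* z ℤ.+ B ℤ.* z ℤ.+ C

disc : ℤ → ℤ → ℤ → ℤ
disc A B C = B ℤ.* B ℤ.- + 4 ℤ.* A ℤ.* C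

IsSquare : ℤ → Set
IsSquare n = ∃ λ k → n ≡ k ℤ.* k

-- Legendre symbol (D/p) = 1: p an odd prime, p ∤ D, and D is a square mod p.
LegendreOne : ℤ → ℕ → Set
LegendreOne D p = Prime p × p ≢ 2 × ¬ ((+ p) ∣ D) × ∃ λ (x : ℤ) → (+ p) ∣ (x ℤ.* x ℤ.- D)

-- The arithmetic progression S = { n : n ≡ q (mod m) } (first difference m, residue q).
InAP : ℤ → ℕ → ℕ → Set
InAP q m n = (+ m) ∣ ((+ n) ℤ.- q)

inAP? : (q : ℤ) (m n : ℕ) → Dec (InAP q m n)
inAP? q m n = m ℕD.∣? ∣ (+ n) ℤ.- q ∣

InfManyGoodPrimes : ℤ → ℤ → ℕ → Set
InfManyGoodPrimes D q m = ∀ N → ∃ λ p → N ℕ.< p × InAP q m p × LegendreOne D p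

primePi : ℕ → ℕ
primePi x = length (filter prime? (upTo (suc x)))

-- All pairs (p , v) with p ≤ x and 0 ≤ v < p; a pair stands for the fraction v/p.
pairsUpTo : ℕ → List (ℕ × ℕ)
pairsUpTo x = concatMap (λ p → map (p ,_) (upTo p)) (upTo (suc x))

-- (p , v) : p ∈ S prime, 0 ≤ v < p, f(v) ≡ 0 (mod p^2)   (v < p is ensured by pairsUpTo)
InY : ℤ → ℤ → ℤ → ℤ → ℕ → ℕ × ℕ → Set
InY A B C q m (p , v) = Prime p × InAP q m p × (+ (p ℕ.* p)) ∣ quad A B C (+ v)

inY? : ∀ A B C q m pv → Dec (InY A B C q m pv)
inY? A B C q m (p , v) =
  prime? p ×-dec (inAP? q m p ×-dec ((p ℕ.* p) ℕD.∣? ∣ quad A B C (+ v) ∣))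

InYa : ℤ → ℤ → ℤ → ℤ → ℕ → ℤ → ℕ × ℕ → Set
InYa A B C q m a (p , v) = Prime p × InAP q m p × quad A B C (+ v) ≡ a ℤ.* (+ (p ℕ.* p))

inYa? : ∀ A B C q m a pv → Dec (InYa A B C q m a pv)
inYa? A B C q m a (p , v) =
  prime? p ×-dec (inAP? q m p ×-dec (quad A B C (+ v) ℤ.≟ a ℤ.* (+ (p ℕ.* p))))

SY : ℤ → ℤ → ℤ → ℤ → ℕ → ℕ → ℕ
SY A B C q m x = length (filter (inY? A B C q m) (pairsUpTo x))

Sa : ℤ → ℤ → ℤ → ℤ → ℕ → ℤ → ℕ → ℕ
Sa A B C q m a x = length (filter (inYa? A B C q m a) (pairsUpTo x))

LittleOPi : (ℕ → ℕ) → Set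
LittleOPi g = ∀ k → 1 ≤ k → ∃ λ X → ∀ x → X ≤ x → k ℕ.* g x ≤ primePi x

module Submission where

-- Completing the square, X = 2Av + B satisfies X² = D + 4A f(v).  Let p be a large prime with
-- p² ∣ f(v) and v < p.  Then f(v) = q p² with 1 ≤ q ≤ K bounded, and 0 < p ≤ X with p ∤ X.  For two
-- such roots (p, v), (p₀, v₀) with the same cofactor q and with p and p₀ in one dyadic block
-- [T, 2T), the difference of squares gives (X p₀ - X₀ p)(X p₀ + X₀ p) = D (p₀² - p²), so
-- |X p₀ - X₀ p| < 2|D|; and as p₀ ∤ X₀, the value X p₀ - X₀ p determines (p, v).  So each of the
-- O(log x) classes (block, cofactor) holds at most 4|D| roots.  Finally log x = o(π(x)) by
-- Chebyshev's bound 2ⁿ ≤ C(2n, n) ≤ (2n+1) C(2n, n) ≤ lcm(1, …, 2n+1) ≤ (2n+1)^π(2n+1).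

module IntegerLogarithm where
  open import Data.Nat
  open import Data.Nat.Properties
  open import Data.Sum using (inj₁; inj₂)
  open import Data.Empty using (⊥-elim)
  open import Relation.Nullary using (yes; no)
  open import Relation.Binary.PropositionalEquality using (_≡_; refl)

  n<m^n : ∀ m .{{_ : NonTrivial m}} n → n < m ^ n
  n<m^n m zero = s≤s z≤n
  n<m^n m (suc n) = begin-strict
    suc n     ≤⟨ n<m^n m n ⟩
    m ^ n     <⟨ m<m*n (m ^ n) m (nonTrivial⇒n>1 m) ⟩
    m ^ n * m ≡⟨ *-comm (m ^ n) m ⟩
    m ^ suc n ∎
    where
      open ≤-Reasoning
      instance _ = m^n≢0 m n {{nonTrivial⇒nonZero m}}

  exponent≤ : ∀ b .{{_ : NonTrivial b}} {n} e → b ^ e ≤ n → e ≤ n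
  exponent≤ b e bᵉ≤n = <⇒≤ (<-≤-trans (n<m^n b e) bᵉ≤n)

  ilogFrom : ℕ → ℕ → ℕ → ℕ
  ilogFrom b n zero = 0
  ilogFrom b n (suc j) with b ^ suc j ≤? n
  ... | yes _ = suc j
  ... | no _ = ilogFrom b n j

  ilog : ℕ → ℕ → ℕ
  ilog b n = ilogFrom b n n

  ^ilogFrom≤ : ∀ b {n} j → 1 ≤ n → b ^ ilogFrom b n j ≤ n
  ^ilogFrom≤ b zero 1≤n = 1≤n
  ^ilogFrom≤ b {n} (suc j) 1≤n with b ^ suc j ≤? n
  ... | yes bʲ≤n = bʲ≤n
  ... | no _ = ^ilogFrom≤ b j 1≤n

  ilogFrom-maximal : ∀ b {n} j {e} → e ≤ j → b ^ e ≤ n → e ≤ ilogFrom b n j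
  ilogFrom-maximal b zero e≤j _ = e≤j
  ilogFrom-maximal b {n} (suc j) e≤j bᵉ≤n with b ^ suc j ≤? n
  ... | yes _ = e≤j
  ... | no bʲ≰n with m≤n⇒m<n∨m≡n e≤j
  ...   | inj₁ e<j = ilogFrom-maximal b j (≤-pred e<j) bᵉ≤n
  ...   | inj₂ refl = ⊥-elim (bʲ≰n bᵉ≤n)

  ^ilog≤ : ∀ b {n} → 1 ≤ n → b ^ ilog b n ≤ n
  ^ilog≤ b {n} = ^ilogFrom≤ b n

  ilog-maximal : ∀ b .{{_ : NonTrivial b}} {n} e → b ^ e ≤ n → e ≤ ilog b n
  ilog-maximal b {n} e bᵉ≤n = ilogFrom-maximal b n (exponent≤ b e bᵉ≤n) bᵉ≤n

  <^1+ilog : ∀ b .{{_ : NonTrivial b}} n → n < b ^ suc (ilog b n)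
  <^1+ilog b n with n <? b ^ suc (ilog b n)
  ... | yes n<b^ = n<b^
  ... | no n≮b^ = ⊥-elim (<-irrefl refl (ilog-maximal b (suc (ilog b n)) (≮⇒≥ n≮b^)))

  ilog-mono-≤ : ∀ b .{{_ : NonTrivial b}} {m n} → 1 ≤ m → m ≤ n → ilog b m ≤ ilog b n
  ilog-mono-≤ b {m} 1≤m m≤n = ilog-maximal b (ilog b m) (≤-trans (^ilog≤ b 1≤m) m≤n)

module Chebyshev where
  open import Data.Nat
  open import Data.Nat.Properties
  open import Data.Nat.Divisibility
  open import Data.Nat.Primality
  open import Data.Nat.Combinatorics using (_C_; nCk+nC[k+1]≡[n+1]C[k+1]; nC1≡n; k>n⇒nCk≡0)
  open import Data.Nat.Induction using (<-wellFounded)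
  open import Data.Nat.ListAction using (product)
  open import Data.Nat.ListAction.Properties using (∈⇒∣product; product≢0)
  open import Data.Nat.Primality.Factorisation using (factorise)
  open import Data.Nat.Tactic.RingSolver using (solve-∀)
  open import Data.List using ([]; _∷_; map; filter; upTo; length)
  open import Data.List.Properties using (length-map)
  open import Data.List.Relation.Unary.All as All using (All; []; _∷_)
  open import Data.List.Relation.Unary.Any using (here)
  open import Data.List.Membership.Propositional.Properties using (∈-map⁺; ∈-map⁻; ∈-filter⁺; ∈-filter⁻; ∈-upTo⁺)
  open import Data.Product using (∃; ∃₂; _×_; _,_)
  open import Data.Sum using (inj₁; inj₂)
  open import Data.Empty using (⊥-elim)
  open import Induction.WellFounded using (Acc; acc)
  open import Relation.Nullary using (¬_; yes; no)
  open import Relation.Binary.PropositionalEquality using (_≡_; refl; sym; trans; cong; cong₂; subst; module ≡-Reasoning)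
  open import Defs using (primePi)
  open IntegerLogarithm

  [k+1]*[n+1]C[k+1]≡[n+1]*nCk : ∀ n k → suc k * (suc n C suc k) ≡ suc n * (n C k)
  [k+1]*[n+1]C[k+1]≡[n+1]*nCk zero zero = refl
  [k+1]*[n+1]C[k+1]≡[n+1]*nCk zero (suc k) = trans (cong (suc (suc k) *_) (k>n⇒nCk≡0 {1} {suc (suc k)} (s≤s (s≤s z≤n)))) (*-zeroʳ (suc (suc k)))
  [k+1]*[n+1]C[k+1]≡[n+1]*nCk (suc n) zero = trans (+-identityʳ _) (trans (nC1≡n (suc (suc n))) (sym (*-identityʳ _)))
  [k+1]*[n+1]C[k+1]≡[n+1]*nCk (suc n) (suc k) = begin
    (2 + k) * (suc (suc n) C suc (suc k))
      ≡⟨ cong ((2 + k) *_) (sym (nCk+nC[k+1]≡[n+1]C[k+1] (suc n) (suc k))) ⟩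
    (2 + k) * (u + w)
      ≡⟨ distrib k u w ⟩
    (1 + k) * u + u + (2 + k) * w
      ≡⟨ cong₂ (λ s t → s + u + t) ([k+1]*[n+1]C[k+1]≡[n+1]*nCk n k) ([k+1]*[n+1]C[k+1]≡[n+1]*nCk n (suc k)) ⟩
    (1 + n) * x + u + (1 + n) * y
      ≡⟨ cong (λ s → (1 + n) * x + s + (1 + n) * y) (sym (nCk+nC[k+1]≡[n+1]C[k+1] n k)) ⟩
    (1 + n) * x + (x + y) + (1 + n) * y
      ≡⟨ collect n x y ⟩
    (2 + n) * (x + y)
      ≡⟨ cong ((2 + n) *_) (nCk+nC[k+1]≡[n+1]C[k+1] n k) ⟩
    (2 + n) * (suc n C suc k) ∎
    where
      open ≡-Reasoning
      x = n C k
      y = n C suc k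
      u = suc n C suc k
      w = suc n C suc (suc k)
      distrib : ∀ k u w → (2 + k) * (u + w) ≡ (1 + k) * u + u + (2 + k) * w
      distrib = solve-∀
      collect : ∀ n x y → (1 + n) * x + (x + y) + (1 + n) * y ≡ (2 + n) * (x + y)
      collect = solve-∀

  nCk≤[n+1]C[k+1] : ∀ n k → n C k ≤ suc n C suc k
  nCk≤[n+1]C[k+1] n k = subst (n C k ≤_) (nCk+nC[k+1]≡[n+1]C[k+1] n k) (m≤m+n _ _)

  nCk≤[n+1]Ck : ∀ n k → n C k ≤ suc n C k
  nCk≤[n+1]Ck n zero = ≤-refl
  nCk≤[n+1]Ck n (suc k) = subst (n C suc k ≤_) (nCk+nC[k+1]≡[n+1]C[k+1] n k) (m≤n+m _ _)

  k≤n⇒nCk>0 : ∀ {n k} → k ≤ n → 0 < n C k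
  k≤n⇒nCk>0 {n} {zero} _ = s≤s z≤n
  k≤n⇒nCk>0 {suc n} {suc k} (s≤s k≤n) = <-≤-trans (k≤n⇒nCk>0 k≤n) (nCk≤[n+1]C[k+1] n k)

  2^n≤[n+n]Cn : ∀ n → 2 ^ n ≤ (n + n) C n
  2^n≤[n+n]Cn zero = ≤-refl
  2^n≤[n+n]Cn (suc n) = begin
    2 ^ n + (2 ^ n + 0)               ≡⟨ cong (2 ^ n +_) (+-identityʳ (2 ^ n)) ⟩
    2 ^ n + 2 ^ n                     ≤⟨ +-mono-≤ (2^n≤[n+n]Cn n) (2^n≤[n+n]Cn n) ⟩
    (n + n) C n + (n + n) C n         ≤⟨ +-mono-≤ (nCk≤[n+1]Ck (n + n) n) (nCk≤[n+1]C[k+1] (n + n) n) ⟩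
    suc (n + n) C n + suc (n + n) C suc n ≡⟨ nCk+nC[k+1]≡[n+1]C[k+1] (suc (n + n)) n ⟩
    suc (suc (n + n)) C suc n         ≡⟨ cong (λ m → suc m C suc n) (sym (+-suc n n)) ⟩
    (suc n + suc n) C suc n           ∎
    where open ≤-Reasoning

  harmonic-∣ : ∀ {a b c Q} .{{_ : NonZero b}} → a * b + c * a ≡ c * b → a ∣ Q → b ∣ Q → c ∣ Q
  harmonic-∣ {a} {b} {c} eq (divides s refl) (divides t sa≡tb) =
    divides (s ∸ t) (*-cancelˡ-≡ _ _ b (begin
      b * (s * a)                       ≡⟨ m+n∸n≡m (b * (s * a)) (c * b * t) ⟨
      b * (s * a) + c * b * t ∸ c * b * t ≡⟨ cong (_∸ c * b * t) expand ⟨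
      c * b * s ∸ c * b * t             ≡⟨ *-distribˡ-∸ (c * b) s t ⟨
      c * b * (s ∸ t)                   ≡⟨ rearrange c b (s ∸ t) ⟩
      b * ((s ∸ t) * c)                 ∎))
    where
      open ≡-Reasoning
      rearrange : ∀ c b d → c * b * d ≡ b * (d * c)
      rearrange = solve-∀
      expand : c * b * s ≡ b * (s * a) + c * b * t
      expand = begin
        c * b * s                 ≡⟨ cong (_* s) eq ⟨
        (a * b + c * a) * s       ≡⟨ distrib a b c s ⟩
        b * (s * a) + c * (s * a) ≡⟨ cong (λ q → b * (s * a) + c * q) sa≡tb ⟩
        b * (s * a) + c * (t * b) ≡⟨ cong (b * (s * a) +_) (swap c t b) ⟩
        b * (s * a) + c * b * t   ∎
        where
          distrib : ∀ a b c s → (a * b + c * a) * s ≡ b * (s * a) + c * (s * a)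
          distrib = solve-∀
          swap : ∀ c t b → c * (t * b) ≡ c * b * t
          swap = solve-∀

  -- The Leibniz harmonic triangle: 1 / ((n+2) C(n+1,k+1)) = 1 / ((n+1) C(n,k)) - 1 / ((n+2) C(n+1,k)).
  leibniz-triangle : ∀ n k →
    let a = suc n * (n C k); b = suc (suc n) * (suc n C k); c = suc (suc n) * (suc n C suc k)
    in a * b + c * a ≡ c * b
  leibniz-triangle n k = begin
    (1 + n) * x * ((2 + n) * u) + (2 + n) * w * ((1 + n) * x) ≡⟨ factor n x u w ⟩
    (2 + n) * ((1 + n) * x) * (u + w)     ≡⟨ cong (λ z → (2 + n) * z * (u + w)) ([k+1]*[n+1]C[k+1]≡[n+1]*nCk n k) ⟨
    (2 + n) * ((1 + k) * w) * (u + w)     ≡⟨ regroup n k w (u + w) ⟩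
    (2 + n) * w * ((1 + k) * (u + w))     ≡⟨ cong (λ z → (2 + n) * w * ((1 + k) * z)) (nCk+nC[k+1]≡[n+1]C[k+1] (suc n) k) ⟩
    (2 + n) * w * ((1 + k) * (suc (suc n) C suc k)) ≡⟨ cong ((2 + n) * w *_) ([k+1]*[n+1]C[k+1]≡[n+1]*nCk (suc n) k) ⟩
    (2 + n) * w * ((2 + n) * u)           ∎
    where
      open ≡-Reasoning
      x = n C k
      u = suc n C k
      w = suc n C suc k
      factor : ∀ n x u w → (1 + n) * x * ((2 + n) * u) + (2 + n) * w * ((1 + n) * x) ≡ (2 + n) * ((1 + n) * x) * (u + w)
      factor = solve-∀
      regroup : ∀ n k w v → (2 + n) * ((1 + k) * w) * v ≡ (2 + n) * w * ((1 + k) * v)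
      regroup = solve-∀

  leibniz-∣ : ∀ {Q M} → (∀ {i} → 1 ≤ i → i ≤ M → i ∣ Q) → ∀ {n k} → k ≤ n → n < M → suc n * (n C k) ∣ Q
  leibniz-∣ {Q} all∣Q {n} {zero} _ n<M = subst (_∣ Q) (sym (*-identityʳ (suc n))) (all∣Q (s≤s z≤n) n<M)
  leibniz-∣ {Q} all∣Q {suc n} {suc k} (s≤s k≤n) n<M =
    harmonic-∣ {a} {b} {c} {Q} {{b≢0}} (leibniz-triangle n k)
      (leibniz-∣ all∣Q k≤n (<-trans (n<1+n n) n<M)) (leibniz-∣ all∣Q (m≤n⇒m≤1+n k≤n) n<M)
    where
      a = suc n * (n C k)
      b = suc (suc n) * (suc n C k)
      c = suc (suc n) * (suc n C suc k)
      b≢0 : NonZero b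
      b≢0 = m*n≢0 (suc (suc n)) (suc n C k) {{_}} {{>-nonZero (k≤n⇒nCk>0 (m≤n⇒m≤1+n k≤n))}}

  prime-divisor : ∀ n → .{{_ : NonTrivial n}} → ∃ λ p → Prime p × p ∣ n
  prime-divisor n with factorise n {{nonTrivial⇒nonZero n}}
  ... | record { factors = [] ; isFactorisation = n≡1 } = ⊥-elim (nonTrivial⇒≢1 {n} n≡1)
  ... | record { factors = p ∷ ps ; isFactorisation = n≡∏ ; factorsPrime = prime-p ∷ _ } =
    p , prime-p , subst (p ∣_) (sym n≡∏) (∈⇒∣product {ns = p ∷ ps} (here refl))

  prime^∣-cancel : ∀ {p j} → Prime p → ¬ p ∣ j → ∀ e {t} → p ^ e ∣ j * t → p ^ e ∣ t
  prime^∣-cancel _ _ zero _ = 1∣ _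
  prime^∣-cancel {p} {j} prime-p p∤j (suc e) {t} pᵉ⁺¹∣jt
    with euclidsLemma j t prime-p (∣-trans (m∣m*n (p ^ e)) pᵉ⁺¹∣jt)
  ... | inj₁ p∣j = ⊥-elim (p∤j p∣j)
  ... | inj₂ (divides t′ refl) =
    subst (p * p ^ e ∣_) (*-comm p t′) (*-monoʳ-∣ p (prime^∣-cancel prime-p p∤j e (*-cancelˡ-∣ p pᵉ⁺¹∣pjt′)))
    where
      instance _ = prime⇒nonZero prime-p
      swap : ∀ j t′ p → j * (t′ * p) ≡ p * (j * t′)
      swap = solve-∀
      pᵉ⁺¹∣pjt′ : p * p ^ e ∣ p * (j * t′)
      pᵉ⁺¹∣pjt′ = subst (p * p ^ e ∣_) (swap j t′ p) pᵉ⁺¹∣jt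

  prime-power-split : ∀ {p} → Prime p → ∀ i → .{{_ : NonZero i}} → ∃₂ λ e j → i ≡ p ^ e * j × ¬ p ∣ j
  prime-power-split {p} prime-p i = split i (<-wellFounded i)
    where
      split : ∀ i → .{{_ : NonZero i}} → Acc _<_ i → ∃₂ λ e j → i ≡ p ^ e * j × ¬ p ∣ j
      split i _ with p ∣? i
      split i _ | no p∤i = 0 , i , sym (+-identityʳ i) , p∤i
      split .(q * p) (acc rec) | yes (divides q refl) with split q {{q≢0}} (rec q<qp)
        where
          q≢0 = m*n≢0⇒m≢0 q
          q<qp = m<m*n q p {{q≢0}} (nonTrivial⇒n>1 p {{prime⇒nonTrivial prime-p}})
      ... | e , j , q≡pᵉj , p∤j = suc e , j , qp≡pᵉ⁺¹j , p∤j
        where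
          reassoc : ∀ p x j → x * j * p ≡ p * x * j
          reassoc = solve-∀
          qp≡pᵉ⁺¹j : q * p ≡ p * p ^ e * j
          qp≡pᵉ⁺¹j = trans (cong (_* p) q≡pᵉj) (reassoc p (p ^ e) j)

  ∣-by-prime-powers : ∀ {Q} i → .{{_ : NonZero i}} → (∀ {p} e → Prime p → p ^ e ∣ i → p ^ e ∣ Q) → i ∣ Q
  ∣-by-prime-powers {Q} i = go i (<-wellFounded i)
    where
      go : ∀ i → .{{_ : NonZero i}} → Acc _<_ i → (∀ {p} e → Prime p → p ^ e ∣ i → p ^ e ∣ Q) → i ∣ Q
      go 1 _ _ = 1∣ Q
      go i@(suc (suc _)) (acc rec) prime-powers∣Q with prime-divisor i
      ... | p , prime-p , p∣i with prime-power-split prime-p i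
      ...   | zero , j , i≡j , p∤j = ⊥-elim (p∤j (subst (p ∣_) (trans i≡j (*-identityˡ j)) p∣i))
      ...   | suc e , zero , i≡0 , _ = ⊥-elim (0≢1+n (sym (trans i≡0 (*-zeroʳ (p ^ suc e)))))
      ...   | suc e , j@(suc _) , i≡pᵉj , p∤j with go j (rec j<i) (λ f prime-r rᶠ∣j → prime-powers∣Q f prime-r (∣-trans rᶠ∣j j∣i))
        where
          instance _ = prime⇒nonZero prime-p
          j∣i : j ∣ i
          j∣i = subst (j ∣_) (sym i≡pᵉj) (n∣m*n (p ^ suc e))
          j<i : j < i
          j<i = subst (j <_) (trans (*-comm j (p ^ suc e)) (sym i≡pᵉj))
                  (m<m*n j (p ^ suc e) (<-≤-trans (nonTrivial⇒n>1 p {{prime⇒nonTrivial prime-p}}) (m≤m*n p (p ^ e) {{m^n≢0 p e}})))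
      ...     | divides t refl = subst (_∣ t * j) (sym i≡pᵉj) (*-monoˡ-∣ j (prime^∣-cancel prime-p p∤j (suc e) pᵉ∣jt))
        where
          pᵉ∣jt : p ^ suc e ∣ j * t
          pᵉ∣jt = subst (p ^ suc e ∣_) (*-comm t j) (prime-powers∣Q (suc e) prime-p (subst (p ^ suc e ∣_) (sym i≡pᵉj) (m∣m*n j)))

  ^-monoʳ-∣ : ∀ m {e f} → e ≤ f → m ^ e ∣ m ^ f
  ^-monoʳ-∣ m {e} {f} e≤f =
    subst (m ^ e ∣_) (trans (sym (^-distribˡ-+-* m e (f ∸ e))) (cong (m ^_) (m+[n∸m]≡n e≤f))) (m∣m*n _)

  product≤^length : ∀ {M ns} → All (_≤ M) ns → product ns ≤ M ^ length ns
  product≤^length [] = ≤-refl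
  product≤^length (n≤M ∷ ns≤M) = *-mono-≤ n≤M (product≤^length ns≤M)

  -- ∏_{p ≤ M prime} p ^ ⌊log_p M⌋, that is, lcm(1, …, M).
  primePowerProduct : ℕ → ℕ
  primePowerProduct M = product (map (λ p → p ^ ilog p M) (filter prime? (upTo (suc M))))

  primePowerProduct≢0 : ∀ M → NonZero (primePowerProduct M)
  primePowerProduct≢0 M = product≢0 (All.tabulate λ x∈ →
    let p , p∈ , x≡ = ∈-map⁻ (λ p → p ^ ilog p M) x∈
        _ , prime-p = ∈-filter⁻ prime? {xs = upTo (suc M)} p∈
    in subst NonZero (sym x≡) (m^n≢0 p (ilog p M) {{prime⇒nonZero prime-p}}))

  primePowerProduct≤ : ∀ {M} → 1 ≤ M → primePowerProduct M ≤ M ^ primePi M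
  primePowerProduct≤ {M} 1≤M =
    subst (λ k → primePowerProduct M ≤ M ^ k) (length-map (λ p → p ^ ilog p M) (filter prime? (upTo (suc M))))
      (product≤^length {ns = map (λ p → p ^ ilog p M) (filter prime? (upTo (suc M)))} (All.tabulate λ x∈ →
        let p , _ , x≡ = ∈-map⁻ (λ p → p ^ ilog p M) x∈ in subst (_≤ M) (sym x≡) (^ilog≤ p 1≤M)))

  ∣primePowerProduct : ∀ {M i} → 1 ≤ i → i ≤ M → i ∣ primePowerProduct M
  ∣primePowerProduct {M} {i} 1≤i i≤M = ∣-by-prime-powers i {{>-nonZero 1≤i}} prime-power∣
    where
      prime-power∣ : ∀ {p} e → Prime p → p ^ e ∣ i → p ^ e ∣ primePowerProduct M
      prime-power∣ zero _ _ = 1∣ _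
      prime-power∣ {p} (suc e) prime-p pᵉ∣i = ∣-trans (^-monoʳ-∣ p (ilog-maximal p (suc e) pᵉ≤M)) pⁱˡᵒᵍ∣
        where
          instance
            _ = prime⇒nonTrivial prime-p
            _ = prime⇒nonZero prime-p
          pᵉ≤M : p ^ suc e ≤ M
          pᵉ≤M = ≤-trans (∣⇒≤ {{>-nonZero 1≤i}} pᵉ∣i) i≤M
          p≤M : p ≤ M
          p≤M = ≤-trans (m≤m*n p (p ^ e) {{m^n≢0 p e}}) pᵉ≤M
          pⁱˡᵒᵍ∣ : p ^ ilog p M ∣ primePowerProduct M
          pⁱˡᵒᵍ∣ = ∈⇒∣product (∈-map⁺ (λ p → p ^ ilog p M) (∈-filter⁺ prime? (∈-upTo⁺ (s≤s p≤M)) prime-p))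

  chebyshev : ∀ n → 2 ^ n ≤ suc (n + n) ^ primePi (suc (n + n))
  chebyshev n = begin
    2 ^ n                          ≤⟨ 2^n≤[n+n]Cn n ⟩
    (n + n) C n                    ≤⟨ m≤n*m ((n + n) C n) (suc (n + n)) ⟩
    suc (n + n) * ((n + n) C n)    ≤⟨ ∣⇒≤ {{primePowerProduct≢0 M}} (leibniz-∣ ∣primePowerProduct (m≤n+m n n) ≤-refl) ⟩
    primePowerProduct M            ≤⟨ primePowerProduct≤ {M} (s≤s z≤n) ⟩
    M ^ primePi M                  ∎
    where
      open ≤-Reasoning
      M = suc (n + n)

module PrimeCounting where
  open import Data.Nat
  open import Data.Nat.Properties
  open import Data.Nat.Primality using (prime?)
  open import Data.Nat.Tactic.RingSolver using (solve-∀)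
  open import Data.List using (length; filter; upTo; [_]; _++_)
  open import Data.List.Properties using (upTo-∷ʳ; filter-++; length-++)
  open import Data.Product using (∃; _,_; proj₁; proj₂)
  open import Data.Empty using (⊥-elim)
  open import Function using (_∘_)
  open import Relation.Nullary using (yes; no)
  open import Relation.Binary.PropositionalEquality using (_≡_; refl; sym; cong; subst)
  open import Defs using (primePi; LittleOPi)
  open IntegerLogarithm
  open Chebyshev using (chebyshev)

  primePi-suc : ∀ x → primePi x ≤ primePi (suc x)
  primePi-suc x = begin
    length (filter prime? xs)                                    ≤⟨ m≤m+n _ _ ⟩
    length (filter prime? xs) + length (filter prime? [ suc x ]) ≡⟨ length-++ (filter prime? xs) ⟨
    length (filter prime? xs ++ filter prime? [ suc x ])         ≡⟨ cong length (filter-++ prime? xs [ suc x ]) ⟨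
    length (filter prime? (xs ++ [ suc x ]))                     ≡⟨ cong (length ∘ filter prime?) (upTo-∷ʳ (suc x)) ⟩
    primePi (suc x)                                              ∎
    where
      open ≤-Reasoning
      xs = upTo (suc x)

  primePi-mono-≤ : ∀ {x y} → x ≤ y → primePi x ≤ primePi y
  primePi-mono-≤ {x} {y} x≤y with m≤n⇒∃[o]m+o≡n x≤y
  ... | d , refl = go d
    where
      go : ∀ d → primePi x ≤ primePi (x + d)
      go zero = ≤-reflexive (cong primePi (sym (+-identityʳ x)))
      go (suc d) = ≤-trans (go d) (≤-trans (primePi-suc (x + d)) (≤-reflexive (cong primePi (sym (+-suc x d)))))

  ^-cancelʳ-≤ : ∀ m .{{_ : NonTrivial m}} {a b} → m ^ a ≤ m ^ b → a ≤ b
  ^-cancelʳ-≤ m {a} {b} mᵃ≤mᵇ with a ≤? b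
  ... | yes a≤b = a≤b
  ... | no a≰b = ⊥-elim (<⇒≱ (^-monoʳ-< m (nonTrivial⇒n>1 m) (≰⇒> a≰b)) mᵃ≤mᵇ)

  2^M≤[3+M]*primePi : ∀ {x} M → ilog 2 x ≡ 2 + M → 2 ^ M ≤ (3 + M) * primePi x
  2^M≤[3+M]*primePi {zero} M ()
  2^M≤[3+M]*primePi {x@(suc _)} M log≡ = ^-cancelʳ-≤ 2 (begin
    2 ^ n                       ≤⟨ chebyshev n ⟩
    y ^ primePi y               ≤⟨ ^-monoˡ-≤ (primePi y) y≤x ⟩
    x ^ primePi y               ≤⟨ ^-monoʳ-≤ x (primePi-mono-≤ y≤x) ⟩
    x ^ primePi x               ≤⟨ ^-monoˡ-≤ (primePi x) (<⇒≤ x<2³⁺ᴹ) ⟩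
    (2 ^ (3 + M)) ^ primePi x   ≡⟨ ^-*-assoc 2 (3 + M) (primePi x) ⟩
    2 ^ ((3 + M) * primePi x)   ∎)
    where
      open ≤-Reasoning
      n = 2 ^ M
      y = suc (n + n)
      y≤x : y ≤ x
      y≤x = begin
        suc (n + n)         ≡⟨ +-comm 1 (n + n) ⟩
        (n + n) + 1         ≤⟨ +-monoʳ-≤ (n + n) (≤-trans (m^n>0 2 M) (m≤m+n n n)) ⟩
        (n + n) + (n + n)   ≡⟨ four n ⟩
        2 ^ (2 + M)         ≡⟨ cong (2 ^_) log≡ ⟨
        2 ^ ilog 2 x        ≤⟨ ^ilog≤ 2 (s≤s z≤n) ⟩
        x                   ∎
        where
          four : ∀ n → (n + n) + (n + n) ≡ 2 * (2 * n)
          four = solve-∀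
      x<2³⁺ᴹ : x < 2 ^ (3 + M)
      x<2³⁺ᴹ = subst (λ e → x < 2 ^ suc e) log≡ (<^1+ilog 2 x)

  exponential-beats-square : ∀ c → ∃ λ M₀ → ∀ {M} → M₀ ≤ M → c * ((3 + M) * (3 + M)) ≤ 2 ^ M
  exponential-beats-square c = 4 * t , λ M₀≤M → from (m≤n⇒∃[o]m+o≡n M₀≤M)
    where
      t = 16 * c
      Bound : ℕ → Set
      Bound M = c * ((3 + M) * (3 + M)) ≤ 2 ^ M
      step : ∀ {M} → Bound M → Bound (suc M)
      step {M} bound = begin
        c * ((4 + M) * (4 + M))                              ≤⟨ m≤m+n _ _ ⟩
        c * ((4 + M) * (4 + M)) + c * (M * M + 4 * M + 2)    ≡⟨ double c M ⟩
        2 * (c * ((3 + M) * (3 + M)))                        ≤⟨ *-monoʳ-≤ 2 bound ⟩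
        2 ^ suc M                                            ∎
        where
          open ≤-Reasoning
          double : ∀ c M → c * ((4 + M) * (4 + M)) + c * (M * M + 4 * M + 2) ≡ 2 * (c * ((3 + M) * (3 + M)))
          double = solve-∀
      base : Bound (4 * t)
      base = begin
        c * ((3 + 4 * t) * (3 + 4 * t))                      ≤⟨ m≤m+n _ _ ⟩
        c * ((3 + 4 * t) * (3 + 4 * t)) + c * (8 * t + 7)    ≡⟨ complete c ⟩
        t * (suc t * suc t)                                  ≤⟨ *-monoˡ-≤ (suc t * suc t) (≤-trans (n≤1+n t) (m≤m*n (suc t) (suc t))) ⟩
        (suc t * suc t) * (suc t * suc t)                    ≤⟨ *-mono-≤ (*-mono-≤ t<2ᵗ t<2ᵗ) (*-mono-≤ t<2ᵗ t<2ᵗ) ⟩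
        (2 ^ t * 2 ^ t) * (2 ^ t * 2 ^ t)                    ≡⟨ fourth-power (2 ^ t) ⟩
        (2 ^ t) ^ 4                                          ≡⟨ ^-*-assoc 2 t 4 ⟩
        2 ^ (t * 4)                                          ≡⟨ cong (2 ^_) (*-comm t 4) ⟩
        2 ^ (4 * t)                                          ∎
        where
          open ≤-Reasoning
          t<2ᵗ = n<m^n 2 t
          complete : ∀ c → c * ((3 + 4 * (16 * c)) * (3 + 4 * (16 * c))) + c * (8 * (16 * c) + 7)
                            ≡ 16 * c * (suc (16 * c) * suc (16 * c))
          complete = solve-∀
          fourth-power : ∀ a → (a * a) * (a * a) ≡ a * (a * (a * (a * 1)))
          fourth-power = solve-∀
      from : ∀ {M} → ∃ (λ d → 4 * t + d ≡ M) → Bound M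
      from (zero , refl) = subst Bound (sym (+-identityʳ (4 * t))) base
      from (suc d , refl) = subst Bound (sym (+-suc (4 * t) d)) (step (from (d , refl)))

  littleO-of-log : ∀ (g : ℕ → ℕ) c₁ c₂ → (∀ x → g x ≤ c₁ + suc (ilog 2 x) * c₂) → LittleOPi g
  littleO-of-log g c₁ c₂ g≤ k _ = 2 ^ (2 + M₀) , bound
    where
      M₀ = proj₁ (exponential-beats-square (k * (c₁ + c₂)))
      bound : ∀ x → 2 ^ (2 + M₀) ≤ x → k * g x ≤ primePi x
      bound x 2²⁺ᴹ⁰≤x with m≤n⇒∃[o]m+o≡n (ilog-maximal 2 (2 + M₀) 2²⁺ᴹ⁰≤x)
      ... | d , log≡ = *-cancelˡ-≤ (3 + M) (begin
        (3 + M) * (k * g x)                                   ≤⟨ *-monoʳ-≤ (3 + M) (*-monoʳ-≤ k (g≤ x)) ⟩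
        (3 + M) * (k * (c₁ + suc (ilog 2 x) * c₂))            ≡⟨ cong (λ L → (3 + M) * (k * (c₁ + suc L * c₂))) log≡ ⟨
        (3 + M) * (k * (c₁ + (3 + M) * c₂))                   ≤⟨ m≤m+n _ _ ⟩
        (3 + M) * (k * (c₁ + (3 + M) * c₂)) + k * c₁ * (3 + M) * (2 + M) ≡⟨ expand k c₁ c₂ M ⟩
        k * (c₁ + c₂) * ((3 + M) * (3 + M))                   ≤⟨ proj₂ (exponential-beats-square (k * (c₁ + c₂))) (m≤m+n M₀ d) ⟩
        2 ^ M                                                 ≤⟨ 2^M≤[3+M]*primePi {x} M (sym log≡) ⟩
        (3 + M) * primePi x                                   ∎)
        where
          open ≤-Reasoning
          M = M₀ + d
          expand : ∀ k c₁ c₂ M → (3 + M) * (k * (c₁ + (3 + M) * c₂)) + k * c₁ * (3 + M) * (2 + M)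
                                  ≡ k * (c₁ + c₂) * ((3 + M) * (3 + M))
          expand = solve-∀

module ListCounting where
  open import Data.Nat
  open import Data.Nat.Properties
  open import Data.Nat.DivMod using (_%_; [m+kn]%n≡m%n; m<n⇒m%n≡m)
  open import Data.List using (List; []; _∷_; length; filter; find; map; upTo)
  open import Data.List.Relation.Unary.Any using (here; there)
  open import Data.List.Relation.Unary.All as All using (All; _∷_)
  import Data.List.Relation.Unary.AllPairs as AllPairs
  import Data.List.Relation.Unary.AllPairs.Properties as AllPairs
  open import Data.List.Relation.Unary.Unique.Propositional using (Unique)
  import Data.List.Relation.Unary.Unique.Propositional.Properties as Unique
  open import Data.List.Relation.Binary.Sublist.Propositional using (⊆-refl)
  open import Data.List.Relation.Binary.Sublist.Propositional.Properties using (filter⁺)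
  open import Data.List.Relation.Binary.Sublist.Heterogeneous.Properties using (length-mono-≤)
  open import Data.List.Membership.Propositional using (_∈_)
  open import Data.List.Membership.Propositional.Properties using (∈-filter⁻; ∈-map⁻; ∈-upTo⁻; ∈-concat⁻′)
  open import Data.Maybe using (Maybe; just; maybe′)
  open import Data.Maybe.Properties using (just-injective)
  open import Data.Product using (∃; _×_; _,_; proj₁; proj₂)
  open import Data.Empty using (⊥-elim)
  open import Function using (_∘_)
  open import Level using (0ℓ)
  open import Relation.Nullary using (yes; no; ¬?)
  open import Relation.Unary using (Pred; Decidable)
  open import Relation.Binary.PropositionalEquality using (_≡_; refl; sym; trans; cong; subst; module ≡-Reasoning)
  open import Defs using (pairsUpTo)

  +-*-injective : ∀ W .{{_ : NonZero W}} {r s a b} → r < W → s < W → r + a * W ≡ s + b * W → r ≡ s × a ≡ b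
  +-*-injective W {r} {s} {a} {b} r<W s<W eq = r≡s , *-cancelʳ-≡ a b W (+-cancelˡ-≡ r _ _ (trans eq (cong (_+ b * W) (sym r≡s))))
    where
      r≡s : r ≡ s
      r≡s = begin
        r                 ≡⟨ m<n⇒m%n≡m r<W ⟨
        r % W             ≡⟨ [m+kn]%n≡m%n r a W ⟨
        (r + a * W) % W   ≡⟨ cong (_% W) eq ⟩
        (s + b * W) % W   ≡⟨ [m+kn]%n≡m%n s b W ⟩
        s % W             ≡⟨ m<n⇒m%n≡m s<W ⟩
        s                 ∎
        where open ≡-Reasoning

  module _ {X : Set} where

    length-filter-split : ∀ {P : Pred X 0ℓ} (P? : Decidable P) xs →
      length xs ≡ length (filter P? xs) + length (filter (¬? ∘ P?) xs)
    length-filter-split P? [] = refl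
    length-filter-split P? (x ∷ xs) with P? x
    ... | yes _ = cong suc (length-filter-split P? xs)
    ... | no _ = trans (cong suc (length-filter-split P? xs)) (sym (+-suc _ _))

    length≤1 : ∀ {xs : List X} → Unique xs → (∀ {x y} → x ∈ xs → y ∈ xs → x ≡ y) → length xs ≤ 1
    length≤1 {[]} _ _ = z≤n
    length≤1 {_ ∷ []} _ _ = s≤s z≤n
    length≤1 {_ ∷ _ ∷ _} ((x≢y ∷ _) AllPairs.∷ _) all≡ = ⊥-elim (x≢y (all≡ (here refl) (there (here refl))))

    pigeonhole : ∀ N {L : List X} (h : X → ℕ) → Unique L →
      (∀ {x y} → x ∈ L → y ∈ L → h x ≡ h y → x ≡ y) → (∀ {x} → x ∈ L → h x < N) → length L ≤ N
    pigeonhole zero {[]} _ _ _ _ = z≤n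
    pigeonhole zero {_ ∷ _} _ _ _ h< = ⊥-elim (n≮0 (h< (here refl)))
    pigeonhole (suc N) {L} h unique injective h< = begin
      length L                                       ≡⟨ length-filter-split top? L ⟩
      length (filter top? L) + length (filter (¬? ∘ top?) L) ≤⟨ +-mono-≤ at-top below-top ⟩
      1 + N                                          ∎
      where
        open ≤-Reasoning
        top? : Decidable (λ x → h x ≡ N)
        top? x = h x ≟ N
        at-top = length≤1 (Unique.filter⁺ top? unique) λ x∈ y∈ →
          let x∈L , hx≡N = ∈-filter⁻ top? {xs = L} x∈
              y∈L , hy≡N = ∈-filter⁻ top? {xs = L} y∈
          in injective x∈L y∈L (trans hx≡N (sym hy≡N))
        below-top = pigeonhole N h (Unique.filter⁺ (¬? ∘ top?) unique)
          (λ x∈ y∈ → injective (proj₁ (∈-filter⁻ (¬? ∘ top?) {xs = L} x∈)) (proj₁ (∈-filter⁻ (¬? ∘ top?) {xs = L} y∈)))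
          (λ x∈ → let x∈L , hx≢N = ∈-filter⁻ (¬? ∘ top?) {xs = L} x∈ in ≤∧≢⇒< (≤-pred (h< x∈L)) hx≢N)

    find-just : ∀ {P : Pred X 0ℓ} (P? : Decidable P) {xs x} → x ∈ xs → P x →
      ∃ λ r → find P? xs ≡ just r × r ∈ xs × P r
    find-just P? {y ∷ xs} x∈ px with P? y
    ... | yes py = y , refl , here refl , py
    find-just P? {y ∷ xs} (here refl) px | no ¬py = ⊥-elim (¬py px)
    find-just P? {y ∷ xs} (there x∈) px | no ¬py =
      let r , found , r∈ , pr = find-just P? x∈ px in r , found , there r∈ , pr

    -- Each class is coded relative to its first member in L, its representative.
    length≤classes*width : ∀ K W .{{_ : NonZero W}} {L : List X} (class : X → ℕ) (offset : X → X → ℕ) → Unique L →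
      (∀ {x} → x ∈ L → class x < K) →
      (∀ {r x} → r ∈ L → x ∈ L → class r ≡ class x → offset r x < W) →
      (∀ {r x y} → r ∈ L → x ∈ L → y ∈ L → class r ≡ class x → class r ≡ class y → offset r x ≡ offset r y → x ≡ y) →
      length L ≤ K * W
    length≤classes*width K W {L} class offset unique class< offset< offset-injective =
      pigeonhole (K * W) code unique code-injective code<
      where
        representative : ℕ → Maybe X
        representative c = find (λ y → class y ≟ c) L

        code : X → ℕ
        code x = maybe′ (λ r → offset r x) 0 (representative (class x)) + class x * W

        code-at : ∀ {x r} → representative (class x) ≡ just r → code x ≡ offset r x + class x * W
        code-at {x} found = cong (λ m → maybe′ (λ r → offset r x) 0 m + class x * W) found

        has-representative : ∀ {x} → x ∈ L → ∃ λ r → representative (class x) ≡ just r × r ∈ L × class r ≡ class x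
        has-representative {x} x∈ = find-just (λ y → class y ≟ class x) x∈ refl

        code< : ∀ {x} → x ∈ L → code x < K * W
        code< {x} x∈ with has-representative x∈
        ... | r , found , r∈ , same = begin-strict
          code x                    ≡⟨ code-at found ⟩
          offset r x + class x * W  <⟨ +-monoˡ-< (class x * W) (offset< r∈ x∈ same) ⟩
          suc (class x) * W         ≤⟨ *-monoˡ-≤ W (class< x∈) ⟩
          K * W                     ∎
          where open ≤-Reasoning

        code-injective : ∀ {x y} → x ∈ L → y ∈ L → code x ≡ code y → x ≡ y
        code-injective {x} {y} x∈ y∈ codes≡ with has-representative x∈ | has-representative y∈
        ... | r , found-x , r∈ , same-x | r′ , found-y , r′∈ , same-y =
          offset-injective r∈ x∈ y∈ same-x (trans same-x classes≡) (trans offsets≡ (cong (λ r → offset r y) r′≡r))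
          where
            decoded = +-*-injective W (offset< r∈ x∈ same-x) (offset< r′∈ y∈ same-y) (trans (sym (code-at found-x)) (trans codes≡ (code-at found-y)))
            offsets≡ = proj₁ decoded
            classes≡ = proj₂ decoded
            r′≡r : r′ ≡ r
            r′≡r = just-injective (trans (sym found-y) (trans (cong representative (sym classes≡)) found-x))

  length-filter-mono : ∀ {A : Set} {P Q : Pred A 0ℓ} (P? : Decidable P) (Q? : Decidable Q) →
    (∀ {w} → P w → Q w) → ∀ xs → length (filter P? xs) ≤ length (filter Q? xs)
  length-filter-mono P? Q? P⇒Q xs = length-mono-≤ (filter⁺ P? Q? (λ { refl → P⇒Q }) (⊆-refl {x = xs}))

  row : ℕ → List (ℕ × ℕ)
  row p = map (p ,_) (upTo p)

  ∈-row⁻ : ∀ {p w} → w ∈ row p → proj₁ w ≡ p × proj₂ w < p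
  ∈-row⁻ {p} w∈ = let v , v∈ , w≡ = ∈-map⁻ (p ,_) w∈ in cong proj₁ w≡ , subst (_< p) (sym (cong proj₂ w≡)) (∈-upTo⁻ v∈)

  pairsUpTo-unique : ∀ x → Unique (pairsUpTo x)
  pairsUpTo-unique x = Unique.concat⁺ rows-unique rows-disjoint
    where
      rows-unique : All Unique (map row (upTo (suc x)))
      rows-unique = All.tabulate λ r∈ → let p , _ , r≡ = ∈-map⁻ row r∈ in
        subst Unique (sym r≡) (Unique.map⁺ (cong proj₂) (Unique.upTo⁺ p))
      rows-disjoint = AllPairs.map⁺ (AllPairs.map
        (λ p≢q {_} (w∈p , w∈q) → p≢q (trans (sym (proj₁ (∈-row⁻ w∈p))) (proj₁ (∈-row⁻ w∈q))))
        (Unique.upTo⁺ (suc x)))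

  ∈-pairsUpTo⁻ : ∀ {x p v} → (p , v) ∈ pairsUpTo x → p ≤ x × v < p
  ∈-pairsUpTo⁻ {x} pv∈ =
    let r , pv∈r , r∈ = ∈-concat⁻′ (map row (upTo (suc x))) pv∈
        q , q∈ , r≡ = ∈-map⁻ row r∈
        p≡q , v<q = ∈-row⁻ (subst (_ ∈_) r≡ pv∈r)
    in subst (_≤ x) (sym p≡q) (≤-pred (∈-upTo⁻ q∈)) , subst (_ <_) (sym p≡q) v<q

module QuadraticRoots where
  open import Data.Nat as ℕ using (ℕ; zero; suc; z≤n; s≤s; _≤?_)
  import Data.Nat.Properties as ℕ
  open import Data.Nat.Divisibility as ℕ using (divides; _∣?_) renaming (_∣_ to _∣ℕ_)
  open import Data.Nat.DivMod using (_/_; m/n*n≡m)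
  open import Data.Nat.Primality using (Prime; prime?; euclidsLemma; prime⇒nonZero)
  import Data.Nat.Tactic.RingSolver as ℕ-Solver
  open import Data.Integer as ℤ using (ℤ; +_; -[1+_]; ∣_∣; _+_; _*_; -_; _-_; _⊖_)
  import Data.Integer.Properties as ℤ
  import Data.Integer.Divisibility.Signed as ℤ∣
  open import Data.Integer.Tactic.RingSolver using (solve-∀)
  open import Algebra.Properties.AbelianGroup ℤ.+-0-abelianGroup using (∙-cancelʳ)
  open import Data.List using (List; filter; length)
  import Data.List.Relation.Unary.Unique.Propositional.Properties as Unique
  open import Data.List.Membership.Propositional using (_∈_)
  open import Data.List.Membership.Propositional.Properties using (∈-filter⁻)
  open import Data.Product using (_×_; _,_; proj₁; proj₂)
  open import Data.Sum using (inj₁; inj₂)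
  open import Data.Empty using (⊥-elim)
  open import Function using (_∘_)
  open import Relation.Nullary using (¬_; ¬?; yes; no)
  open import Relation.Nullary.Decidable using (_×-dec_)
  open import Relation.Unary using (Decidable)
  open import Relation.Binary.PropositionalEquality using (_≡_; refl; sym; trans; cong; cong₂; subst; module ≡-Reasoning)
  open import Defs using (quad; disc; IsSquare; pairsUpTo)
  open IntegerLogarithm
  open ListCounting

  +∣i∣*+∣i∣≡i*i : ∀ i → + (∣ i ∣ ℕ.* ∣ i ∣) ≡ i * i
  +∣i∣*+∣i∣≡i*i (+ n) = ℤ.pos-* n n
  +∣i∣*+∣i∣≡i*i -[1+ n ] = refl

  cross-identity : ∀ X X₀ D c p p₀ → X * X ≡ D + c * (p * p) → X₀ * X₀ ≡ D + c * (p₀ * p₀) →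
    (X * p₀ - X₀ * p) * (X * p₀ + X₀ * p) ≡ D * (p₀ * p₀ - p * p)
  cross-identity X X₀ D c p p₀ X² X₀² = begin
    (X * p₀ - X₀ * p) * (X * p₀ + X₀ * p)                    ≡⟨ difference-of-squares X X₀ p p₀ ⟩
    (X * X) * (p₀ * p₀) - (X₀ * X₀) * (p * p)                ≡⟨ cong₂ (λ s t → s * (p₀ * p₀) - t * (p * p)) X² X₀² ⟩
    (D + c * (p * p)) * (p₀ * p₀) - (D + c * (p₀ * p₀)) * (p * p) ≡⟨ cancel D c p p₀ ⟩
    D * (p₀ * p₀ - p * p)                                    ∎
    where
      open ≡-Reasoning
      difference-of-squares : ∀ X X₀ p p₀ → (X * p₀ - X₀ * p) * (X * p₀ + X₀ * p) ≡ (X * X) * (p₀ * p₀) - (X₀ * X₀) * (p * p)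
      difference-of-squares = solve-∀
      cancel : ∀ D c p p₀ → (D + c * (p * p)) * (p₀ * p₀) - (D + c * (p₀ * p₀)) * (p * p) ≡ D * (p₀ * p₀ - p * p)
      cancel = solve-∀

  i≡j+k⇒j≡i-k : ∀ i j k → i ≡ j + k → j ≡ i - k
  i≡j+k⇒j≡i-k i j k i≡j+k = trans (add-sub j k) (cong (_- k) (sym i≡j+k))
    where
      add-sub : ∀ j k → j ≡ (j + k) - k
      add-sub = solve-∀

  i≡j+k⇒k≡i-j : ∀ i j k → i ≡ j + k → k ≡ i - j
  i≡j+k⇒k≡i-j i j k i≡j+k = i≡j+k⇒j≡i-k i k j (trans i≡j+k (ℤ.+-comm j k))

  i-j≡k-l⇒i-k≡j-l : ∀ i j k l → i - j ≡ k - l → i - k ≡ j - l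
  i-j≡k-l⇒i-k≡j-l i j k l eq = ∙-cancelʳ (k - l) (i - k) (j - l) (begin
    i - k + (k - l)   ≡⟨ regroup i j k l ⟩
    j - l + (i - j)   ≡⟨ cong (λ z → j - l + z) eq ⟩
    j - l + (k - l)   ∎)
    where
      open ≡-Reasoning
      regroup : ∀ i j k l → i - k + (k - l) ≡ j - l + (i - j)
      regroup = solve-∀

  InBlock : ℕ → ℕ → Set
  InBlock T p = T ℕ.≤ p × p ℕ.< T ℕ.+ T

  ∸<-InBlock : ∀ {T a b} → .{{_ : ℕ.NonZero T}} → T ℕ.≤ a → b ℕ.< T ℕ.+ T → b ℕ.∸ a ℕ.< T
  ∸<-InBlock {T} {a} {b} T≤a b<2T = ℕ.m<n+o⇒m∸n<o b a (ℕ.<-≤-trans b<2T (ℕ.+-monoˡ-≤ T T≤a))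

  ∣⊖∣<-InBlock : ∀ {T a b} → InBlock T a → InBlock T b → ∣ a ⊖ b ∣ ℕ.< T
  ∣⊖∣<-InBlock {zero} _ (_ , ())
  ∣⊖∣<-InBlock {T@(suc _)} {a} {b} (T≤a , a<2T) (T≤b , b<2T) with ℕ.≤-total a b
  ... | inj₁ a≤b = subst (ℕ._< T) (sym (ℤ.∣⊖∣-≤ a≤b)) (∸<-InBlock T≤a b<2T)
  ... | inj₂ b≤a = subst (ℕ._< T) (sym (trans (ℤ.∣m⊖n∣≡∣n⊖m∣ a b) (ℤ.∣⊖∣-≤ b≤a))) (∸<-InBlock T≤b a<2T)

  ∸1< : ∀ {q K} → 1 ℕ.≤ q → q ℕ.≤ K → q ℕ.∸ 1 ℕ.< K
  ∸1< {suc _} _ q≤K = q≤K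

  InBlock-ilog : ∀ {p} → 1 ℕ.≤ p → InBlock (2 ℕ.^ ilog 2 p) p
  InBlock-ilog {p} 1≤p = ^ilog≤ 2 1≤p , subst (p ℕ.<_) (cong (2 ℕ.^ ilog 2 p ℕ.+_) (ℕ.+-identityʳ _)) (<^1+ilog 2 p)

  +∣i+n∣≡i+n : ∀ i {n} → ∣ i ∣ ℕ.≤ n → + ∣ i + + n ∣ ≡ i + + n
  +∣i+n∣≡i+n (+ a) {n} _ = trans (cong (λ z → + ∣ z ∣) (sym (ℤ.pos-+ a n))) (ℤ.pos-+ a n)
  +∣i+n∣≡i+n -[1+ a ] ∣i∣≤n = trans (cong (λ z → + ∣ z ∣) i+n≡) (sym i+n≡)
    where i+n≡ = ℤ.⊖-≥ ∣i∣≤n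

  module Roots (A₀ : ℕ) (B C : ℤ) (D-nonsquare : ¬ IsSquare (disc (+ suc A₀) B C)) where

    A D : ℤ
    A = + suc A₀
    D = disc A B C

    f : ℕ → ℤ
    f v = quad A B C (+ v)

    X : ℕ → ℤ
    X v = + 2 * A * + v + B

    X²≡D+4Af : ∀ v → X v * X v ≡ D + + 4 * A * f v
    X²≡D+4Af v = complete-square A B C (+ v)
      where
        complete-square : ∀ A B C v → (+ 2 * A * v + B) * (+ 2 * A * v + B) ≡ (B * B - + 4 * A * C) + + 4 * A * (A * v * v + B * v + C)
        complete-square = solve-∀

    1≤∣D∣ : 1 ℕ.≤ ∣ D ∣
    1≤∣D∣ = nonzero D refl
      where
        nonzero : ∀ E → D ≡ E → 1 ℕ.≤ ∣ E ∣
        nonzero (+ zero) D≡0 = ⊥-elim (D-nonsquare (+ 0 , D≡0))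
        nonzero (+ suc _) _ = s≤s z≤n
        nonzero -[1+ _ ] _ = s≤s z≤n

    P₀ : ℕ
    P₀ = suc (∣ B ∣ ℕ.+ ∣ D ∣)

    K : ℕ
    K = suc A₀ ℕ.+ ∣ B ∣ ℕ.+ ∣ C ∣

    ∣f∣≤K*p² : ∀ {p v} → v ℕ.< p → ∣ f v ∣ ℕ.≤ K ℕ.* (p ℕ.* p)
    ∣f∣≤K*p² {p} {v} v<p = begin
      ∣ A * + v * + v + B * + v + C ∣                    ≤⟨ ℤ.∣i+j∣≤∣i∣+∣j∣ (A * + v * + v + B * + v) C ⟩
      ∣ A * + v * + v + B * + v ∣ ℕ.+ ∣ C ∣              ≤⟨ ℕ.+-monoˡ-≤ ∣ C ∣ (ℤ.∣i+j∣≤∣i∣+∣j∣ (A * + v * + v) (B * + v)) ⟩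
      ∣ A * + v * + v ∣ ℕ.+ ∣ B * + v ∣ ℕ.+ ∣ C ∣         ≡⟨ cong₂ (λ s t → s ℕ.+ t ℕ.+ ∣ C ∣) (trans (ℤ.abs-* (A * + v) (+ v)) (cong (ℕ._* v) (ℤ.abs-* A (+ v)))) (ℤ.abs-* B (+ v)) ⟩
      suc A₀ ℕ.* v ℕ.* v ℕ.+ ∣ B ∣ ℕ.* v ℕ.+ ∣ C ∣        ≤⟨ ℕ.+-mono-≤ (ℕ.+-mono-≤ (ℕ.*-mono-≤ (ℕ.*-monoʳ-≤ (suc A₀) v≤p) v≤p) (ℕ.*-monoʳ-≤ ∣ B ∣ v≤p²)) (ℕ.m≤m*n ∣ C ∣ (p ℕ.* p) {{p²≢0}}) ⟩
      suc A₀ ℕ.* p ℕ.* p ℕ.+ ∣ B ∣ ℕ.* (p ℕ.* p) ℕ.+ ∣ C ∣ ℕ.* (p ℕ.* p) ≡⟨ collect (suc A₀) ∣ B ∣ ∣ C ∣ p ⟩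
      K ℕ.* (p ℕ.* p)                                     ∎
      where
        open ℕ.≤-Reasoning
        v≤p = ℕ.<⇒≤ v<p
        1≤p = ℕ.<-≤-trans (s≤s z≤n) v<p
        v≤p² = ℕ.≤-trans v≤p (ℕ.m≤m*n p p {{ℕ.>-nonZero 1≤p}})
        p²≢0 = ℕ.>-nonZero (ℕ.*-mono-≤ 1≤p 1≤p)
        collect : ∀ a b c p → a ℕ.* p ℕ.* p ℕ.+ b ℕ.* (p ℕ.* p) ℕ.+ c ℕ.* (p ℕ.* p) ≡ (a ℕ.+ b ℕ.+ c) ℕ.* (p ℕ.* p)
        collect = ℕ-Solver.solve-∀

    -- |f(v)| / p², with junk value 0 at p = 0.
    cofactor : ℕ → ℕ → ℕ
    cofactor zero _ = 0
    cofactor p@(suc _) v = ∣ f v ∣ / (p ℕ.* p)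

    ∣f∣≡cofactor*p² : ∀ {p v} → p ℕ.* p ∣ℕ ∣ f v ∣ → ∣ f v ∣ ≡ cofactor p v ℕ.* (p ℕ.* p)
    ∣f∣≡cofactor*p² {zero} p²∣f = ℕ.0∣⇒≡0 p²∣f
    ∣f∣≡cofactor*p² {suc _} p²∣f = sym (m/n*n≡m p²∣f)

    +4A*+n≡+[4A*n] : ∀ n → + 4 * A * + n ≡ + (4 ℕ.* suc A₀ ℕ.* n)
    +4A*+n≡+[4A*n] n = trans (cong (_* + n) (sym (ℤ.pos-* 4 (suc A₀)))) (sym (ℤ.pos-* (4 ℕ.* suc A₀) n))

    record LargeRoot (p v : ℕ) : Set where
      field
        1≤cofactor : 1 ℕ.≤ cofactor p v
        cofactor≤K : cofactor p v ℕ.≤ K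
        X≡+∣X∣ : X v ≡ + ∣ X v ∣
        p≤∣X∣ : p ℕ.≤ ∣ X v ∣
        p∤∣X∣ : ¬ p ∣ℕ ∣ X v ∣
        X²≡D+cp² : X v * X v ≡ D + + (4 ℕ.* suc A₀ ℕ.* cofactor p v) * (+ p * + p)

    module _ {p v : ℕ} (P₀≤p : P₀ ℕ.≤ p) (v<p : v ℕ.< p) (p²∣f : p ℕ.* p ∣ℕ ∣ f v ∣) where
      private
        q = cofactor p v
        m = ∣ f v ∣
        s = ∣ X v ∣ ℕ.* ∣ X v ∣
        4Am = 4 ℕ.* suc A₀ ℕ.* m

        m≡qp² : m ≡ q ℕ.* (p ℕ.* p)
        m≡qp² = ∣f∣≡cofactor*p² {p} {v} p²∣f
        1≤p : 1 ℕ.≤ p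
        1≤p = ℕ.<-≤-trans (s≤s z≤n) v<p
        p≤p² : p ℕ.≤ p ℕ.* p
        p≤p² = ℕ.m≤m*n p p {{ℕ.>-nonZero 1≤p}}
        ∣B∣<p : ∣ B ∣ ℕ.< p
        ∣B∣<p = ℕ.<-≤-trans (s≤s (ℕ.m≤m+n ∣ B ∣ ∣ D ∣)) P₀≤p
        ∣D∣<p : ∣ D ∣ ℕ.< p
        ∣D∣<p = ℕ.<-≤-trans (s≤s (ℕ.m≤n+m ∣ D ∣ ∣ B ∣)) P₀≤p

        1≤cofactor : 1 ℕ.≤ q
        1≤cofactor with q in q≡
        ... | suc _ = s≤s z≤n
        ... | zero = ⊥-elim (D-nonsquare (X v , sym (begin
          X v * X v             ≡⟨ X²≡D+4Af v ⟩
          D + + 4 * A * f v     ≡⟨ cong (λ z → D + + 4 * A * z) f≡0 ⟩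
          D + + 4 * A * + 0     ≡⟨ cong (λ z → D + z) (ℤ.*-zeroʳ (+ 4 * A)) ⟩
          D + + 0               ≡⟨ ℤ.+-identityʳ D ⟩
          D                     ∎)))
          where
            open ≡-Reasoning
            f≡0 : f v ≡ + 0
            f≡0 = ℤ.∣i∣≡0⇒i≡0 (trans m≡qp² (cong (ℕ._* (p ℕ.* p)) q≡))

        cofactor≤K : q ℕ.≤ K
        cofactor≤K = ℕ.*-cancelʳ-≤ q K (p ℕ.* p) {{ℕ.>-nonZero (ℕ.*-mono-≤ 1≤p 1≤p)}}
          (subst (ℕ._≤ K ℕ.* (p ℕ.* p)) m≡qp² (∣f∣≤K*p² {p} {v} v<p))

        p²≤m : p ℕ.* p ℕ.≤ m
        p²≤m = subst (p ℕ.* p ℕ.≤_) (sym m≡qp²)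
          (ℕ.≤-trans (ℕ.≤-reflexive (sym (ℕ.*-identityˡ (p ℕ.* p)))) (ℕ.*-monoˡ-≤ (p ℕ.* p) 1≤cofactor))

        2p²≤4Am : p ℕ.* p ℕ.+ p ℕ.* p ℕ.≤ 4Am
        2p²≤4Am = ℕ.≤-trans (ℕ.+-mono-≤ p²≤m p²≤m) (subst (m ℕ.+ m ℕ.≤_) (sym (split A₀ m)) (ℕ.m≤m+n (m ℕ.+ m) _))
          where
            split : ∀ a m → 4 ℕ.* suc a ℕ.* m ≡ m ℕ.+ m ℕ.+ (2 ℕ.* m ℕ.+ 4 ℕ.* a ℕ.* m)
            split = ℕ-Solver.solve-∀

        +s≡D+4Af : + s ≡ D + + 4 * A * f v
        +s≡D+4Af = trans (+∣i∣*+∣i∣≡i*i (X v)) (X²≡D+4Af v)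

        -- If f(v) were negative, D = X² + 4A|f(v)| ≥ p² would exceed |D|.
        f≡+m : f v ≡ + m
        f≡+m with ℤ.+∣i∣≡i⊎+∣i∣≡-i (f v)
        ... | inj₁ +m≡f = sym +m≡f
        ... | inj₂ +m≡-f = ⊥-elim (ℕ.<-irrefl refl (ℕ.<-≤-trans ∣D∣<p (ℕ.≤-trans p≤4Am 4Am≤∣D∣)))
          where
            open ≡-Reasoning
            minus-negative : ∀ S a t → S - a * - t ≡ S + a * t
            minus-negative = solve-∀
            D≡s+4Am : D ≡ + (s ℕ.+ 4Am)
            D≡s+4Am = begin
              D                        ≡⟨ i≡j+k⇒j≡i-k (+ s) D (+ 4 * A * f v) +s≡D+4Af ⟩
              + s - + 4 * A * f v      ≡⟨ cong (λ z → + s - + 4 * A * z) (trans (sym (ℤ.neg-involutive (f v))) (cong -_ (sym +m≡-f))) ⟩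
              + s - + 4 * A * - + m    ≡⟨ minus-negative (+ s) (+ 4 * A) (+ m) ⟩
              + s + + 4 * A * + m      ≡⟨ cong (λ z → + s + z) (+4A*+n≡+[4A*n] m) ⟩
              + s + + 4Am              ≡⟨ ℤ.pos-+ s 4Am ⟨
              + (s ℕ.+ 4Am)            ∎
            p≤4Am : p ℕ.≤ 4Am
            p≤4Am = ℕ.≤-trans p≤p² (ℕ.≤-trans p²≤m (ℕ.m≤n*m m (4 ℕ.* suc A₀)))
            4Am≤∣D∣ : 4Am ℕ.≤ ∣ D ∣
            4Am≤∣D∣ = subst (4Am ℕ.≤_) (sym (cong ∣_∣ D≡s+4Am)) (ℕ.m≤n+m 4Am s)

        +s≡D+4Am : + s ≡ D + + 4Am
        +s≡D+4Am = trans +s≡D+4Af (cong (λ z → D + z) (trans (cong (λ z → + 4 * A * z) f≡+m) (+4A*+n≡+[4A*n] m)))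

        4Am≤s+∣D∣ : 4Am ℕ.≤ s ℕ.+ ∣ D ∣
        4Am≤s+∣D∣ = subst (ℕ._≤ s ℕ.+ ∣ D ∣) (cong ∣_∣ (sym (i≡j+k⇒k≡i-j (+ s) D (+ 4Am) +s≡D+4Am))) (ℤ.∣i-j∣≤∣i∣+∣j∣ (+ s) D)

        -- X² = D + 4A|f(v)| ≥ 4p² - |D| rules out |X| < p.
        p≤∣X∣ : p ℕ.≤ ∣ X v ∣
        p≤∣X∣ with p ℕ.≤? ∣ X v ∣
        ... | yes p≤∣X∣ = p≤∣X∣
        ... | no p≰∣X∣ = ⊥-elim (ℕ.<-irrefl refl (begin-strict
          4Am                       ≤⟨ 4Am≤s+∣D∣ ⟩
          s ℕ.+ ∣ D ∣               <⟨ ℕ.+-mono-< (ℕ.*-mono-< ∣X∣<p ∣X∣<p) (ℕ.<-≤-trans ∣D∣<p p≤p²) ⟩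
          p ℕ.* p ℕ.+ p ℕ.* p       ≤⟨ 2p²≤4Am ⟩
          4Am                       ∎))
          where
            open ℕ.≤-Reasoning
            ∣X∣<p = ℕ.≰⇒> p≰∣X∣

        X≡+∣X∣ : X v ≡ + ∣ X v ∣
        X≡+∣X∣ with ℤ.+∣i∣≡i⊎+∣i∣≡-i (X v)
        ... | inj₁ +∣X∣≡X = sym +∣X∣≡X
        ... | inj₂ +∣X∣≡-X = ⊥-elim (ℕ.<-irrefl refl (ℕ.<-≤-trans ∣B∣<p (ℕ.≤-trans p≤∣X∣ ∣X∣≤∣B∣)))
          where
            open ≡-Reasoning
            B≡ : B ≡ - (+ ∣ X v ∣ + + 2 * A * + v)
            B≡ = begin
              B                                     ≡⟨ isolate (+ 2 * A * + v) B ⟩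
              - (- (+ 2 * A * + v + B) + + 2 * A * + v) ≡⟨ cong (λ z → - (z + + 2 * A * + v)) +∣X∣≡-X ⟨
              - (+ ∣ X v ∣ + + 2 * A * + v)         ∎
              where
                isolate : ∀ t B → B ≡ - (- (t + B) + t)
                isolate = solve-∀
            ∣X∣≤∣B∣ : ∣ X v ∣ ℕ.≤ ∣ B ∣
            ∣X∣≤∣B∣ = subst (∣ X v ∣ ℕ.≤_) (sym ∣B∣≡) (ℕ.m≤m+n ∣ X v ∣ (2 ℕ.* suc A₀ ℕ.* v))
              where
                ∣B∣≡ : ∣ B ∣ ≡ ∣ X v ∣ ℕ.+ 2 ℕ.* suc A₀ ℕ.* v
                ∣B∣≡ = begin
                  ∣ B ∣                                     ≡⟨ cong ∣_∣ B≡ ⟩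
                  ∣ - (+ ∣ X v ∣ + + 2 * A * + v) ∣         ≡⟨ ℤ.∣-i∣≡∣i∣ (+ ∣ X v ∣ + + 2 * A * + v) ⟩
                  ∣ + ∣ X v ∣ + + 2 * A * + v ∣             ≡⟨ cong (λ z → ∣ + ∣ X v ∣ + z ∣) +2A*+v≡ ⟩
                  ∣ + ∣ X v ∣ + + (2 ℕ.* suc A₀ ℕ.* v) ∣    ≡⟨ cong ∣_∣ (ℤ.pos-+ ∣ X v ∣ (2 ℕ.* suc A₀ ℕ.* v)) ⟨
                  ∣ X v ∣ ℕ.+ 2 ℕ.* suc A₀ ℕ.* v            ∎
                  where
                    +2A*+v≡ : + 2 * A * + v ≡ + (2 ℕ.* suc A₀ ℕ.* v)
                    +2A*+v≡ = trans (cong (_* + v) (sym (ℤ.pos-* 2 (suc A₀)))) (sym (ℤ.pos-* (2 ℕ.* suc A₀) v))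

        -- p | X would give p | X² - 4A f(v) = D, impossible as 0 < |D| < p.
        p∤∣X∣ : ¬ p ∣ℕ ∣ X v ∣
        p∤∣X∣ p∣X = ℕ.<⇒≱ ∣D∣<p (ℕ.∣⇒≤ {{ℕ.>-nonZero 1≤∣D∣}} (ℤ∣.∣⇒∣ᵤ p∣D))
          where
            p∣4Af : + p ℤ∣.∣ + 4 * A * f v
            p∣4Af = ℤ∣.∣n⇒∣m*n (+ 4 * A) (subst (+ p ℤ∣.∣_) (sym f≡+m) (ℤ∣.∣ᵤ⇒∣ (ℕ.∣-trans (ℕ.m∣m*n p) (divides q m≡qp²))))
            p∣D+4Af : + p ℤ∣.∣ D + + 4 * A * f v
            p∣D+4Af = subst (+ p ℤ∣.∣_) (X²≡D+4Af v) (ℤ∣.∣m⇒∣m*n {+ p} {X v} (X v) (ℤ∣.∣ᵤ⇒∣ {+ p} {X v} p∣X))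
            p∣D : + p ℤ∣.∣ D
            p∣D = ℤ∣.∣m+n∣n⇒∣m p∣D+4Af p∣4Af

        X²≡D+cp² : X v * X v ≡ D + + (4 ℕ.* suc A₀ ℕ.* q) * (+ p * + p)
        X²≡D+cp² = begin
          X v * X v                                   ≡⟨ +∣i∣*+∣i∣≡i*i (X v) ⟨
          + s                                         ≡⟨ +s≡D+4Am ⟩
          D + + (4 ℕ.* suc A₀ ℕ.* m)                  ≡⟨ cong (λ z → D + + (4 ℕ.* suc A₀ ℕ.* z)) m≡qp² ⟩
          D + + (4 ℕ.* suc A₀ ℕ.* (q ℕ.* (p ℕ.* p)))   ≡⟨ cong (λ z → D + + z) (ℕ.*-assoc (4 ℕ.* suc A₀) q (p ℕ.* p)) ⟨
          D + + (4 ℕ.* suc A₀ ℕ.* q ℕ.* (p ℕ.* p))     ≡⟨ cong (λ z → D + z) (ℤ.pos-* (4 ℕ.* suc A₀ ℕ.* q) (p ℕ.* p)) ⟩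
          D + + (4 ℕ.* suc A₀ ℕ.* q) * + (p ℕ.* p)     ≡⟨ cong (λ z → D + + (4 ℕ.* suc A₀ ℕ.* q) * z) (ℤ.pos-* p p) ⟩
          D + + (4 ℕ.* suc A₀ ℕ.* q) * (+ p * + p)     ∎
          where open ≡-Reasoning

      largeRoot : LargeRoot p v
      largeRoot = record
        { 1≤cofactor = 1≤cofactor
        ; cofactor≤K = cofactor≤K
        ; X≡+∣X∣ = X≡+∣X∣
        ; p≤∣X∣ = p≤∣X∣
        ; p∤∣X∣ = p∤∣X∣
        ; X²≡D+cp² = X²≡D+cp²
        }

    cross : ℕ × ℕ → ℕ × ℕ → ℤ
    cross (p , v) (p₀ , v₀) = X v * + p₀ - X v₀ * + p

    -- cross · (X p₀ + X₀ p) = D (p₀² - p²), with the second factor at least 2T² and |p₀² - p²| < 4T².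
    ∣cross∣<2∣D∣ : ∀ {T p v p₀ v₀} → LargeRoot p v → LargeRoot p₀ v₀ → cofactor p v ≡ cofactor p₀ v₀ →
      InBlock T p → InBlock T p₀ → ∣ cross (p , v) (p₀ , v₀) ∣ ℕ.< ∣ D ∣ ℕ.+ ∣ D ∣
    ∣cross∣<2∣D∣ {T} {p} {v} {p₀} {v₀} root root₀ same-cofactor (T≤p , p<2T) (T≤p₀ , p₀<2T) =
      ℕ.*-cancelʳ-< (T ℕ.* T ℕ.+ T ℕ.* T) δ (∣ D ∣ ℕ.+ ∣ D ∣) (begin-strict
        δ ℕ.* (T ℕ.* T ℕ.+ T ℕ.* T)            ≤⟨ ℕ.*-monoʳ-≤ δ 2T²≤S ⟩
        δ ℕ.* S                                ≡⟨ δS≡∣D∣Δ ⟩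
        ∣ D ∣ ℕ.* Δ                            <⟨ ℕ.*-monoʳ-< ∣ D ∣ {{ℕ.>-nonZero 1≤∣D∣}} Δ<4T² ⟩
        ∣ D ∣ ℕ.* ((T ℕ.+ T) ℕ.* (T ℕ.+ T))    ≡⟨ regroup ∣ D ∣ T ⟩
        (∣ D ∣ ℕ.+ ∣ D ∣) ℕ.* (T ℕ.* T ℕ.+ T ℕ.* T) ∎)
      where
        open ℕ.≤-Reasoning
        open LargeRoot root
        open LargeRoot root₀ renaming (X≡+∣X∣ to X₀≡+∣X₀∣; p≤∣X∣ to p₀≤∣X₀∣; X²≡D+cp² to X₀²≡D+cp₀²)
          using ()
        δ = ∣ cross (p , v) (p₀ , v₀) ∣
        S = ∣ X v ∣ ℕ.* p₀ ℕ.+ ∣ X v₀ ∣ ℕ.* p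
        Δ = ∣ (p₀ ℕ.* p₀) ⊖ (p ℕ.* p) ∣
        c = + (4 ℕ.* suc A₀ ℕ.* cofactor p v)
        regroup : ∀ d t → d ℕ.* ((t ℕ.+ t) ℕ.* (t ℕ.+ t)) ≡ (d ℕ.+ d) ℕ.* (t ℕ.* t ℕ.+ t ℕ.* t)
        regroup = ℕ-Solver.solve-∀
        2T²≤S : T ℕ.* T ℕ.+ T ℕ.* T ℕ.≤ S
        2T²≤S = ℕ.+-mono-≤ (ℕ.*-mono-≤ (ℕ.≤-trans T≤p p≤∣X∣) T≤p₀) (ℕ.*-mono-≤ (ℕ.≤-trans T≤p₀ p₀≤∣X₀∣) T≤p)
        Δ<4T² : Δ ℕ.< (T ℕ.+ T) ℕ.* (T ℕ.+ T)
        Δ<4T² = ℕ.≤-<-trans (ℤ.∣m⊝n∣≤m⊔n (p₀ ℕ.* p₀) (p ℕ.* p))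
          (ℕ.⊔-lub (ℕ.*-mono-< p₀<2T p₀<2T) (ℕ.*-mono-< p<2T p<2T))
        +S≡ : + S ≡ X v * + p₀ + X v₀ * + p
        +S≡ = trans (ℤ.pos-+ (∣ X v ∣ ℕ.* p₀) (∣ X v₀ ∣ ℕ.* p))
          (trans (cong₂ _+_ (ℤ.pos-* ∣ X v ∣ p₀) (ℤ.pos-* ∣ X v₀ ∣ p))
            (sym (cong₂ (λ a b → a * + p₀ + b * + p) X≡+∣X∣ X₀≡+∣X₀∣)))
        δS≡∣D∣Δ : δ ℕ.* S ≡ ∣ D ∣ ℕ.* Δ
        δS≡∣D∣Δ = begin-equality
          δ ℕ.* S                                      ≡⟨ ℤ.abs-* (cross (p , v) (p₀ , v₀)) (+ S) ⟨
          ∣ cross (p , v) (p₀ , v₀) * + S ∣            ≡⟨ cong (λ z → ∣ cross (p , v) (p₀ , v₀) * z ∣) +S≡ ⟩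
          ∣ cross (p , v) (p₀ , v₀) * (X v * + p₀ + X v₀ * + p) ∣ ≡⟨ cong ∣_∣ (cross-identity (X v) (X v₀) D c (+ p) (+ p₀) X²≡D+cp²
                                                             (subst (λ q → X v₀ * X v₀ ≡ D + + (4 ℕ.* suc A₀ ℕ.* q) * (+ p₀ * + p₀)) (sym same-cofactor) X₀²≡D+cp₀²)) ⟩
          ∣ D * (+ p₀ * + p₀ - + p * + p) ∣             ≡⟨ ℤ.abs-* D (+ p₀ * + p₀ - + p * + p) ⟩
          ∣ D ∣ ℕ.* ∣ + p₀ * + p₀ - + p * + p ∣          ≡⟨ cong (λ z → ∣ D ∣ ℕ.* ∣ z ∣) (trans (sym (cong₂ _-_ (ℤ.pos-* p₀ p₀) (ℤ.pos-* p p))) (ℤ.m-n≡m⊖n (p₀ ℕ.* p₀) (p ℕ.* p))) ⟩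
          ∣ D ∣ ℕ.* Δ                                   ∎

    cross-injective : ∀ {T p₀ v₀ p₁ v₁ p₂ v₂} → Prime p₀ → ¬ p₀ ∣ℕ ∣ X v₀ ∣ → T ℕ.≤ p₀ →
      InBlock T p₁ → InBlock T p₂ → cross (p₁ , v₁) (p₀ , v₀) ≡ cross (p₂ , v₂) (p₀ , v₀) → (p₁ , v₁) ≡ (p₂ , v₂)
    cross-injective {T} {p₀} {v₀} {p₁} {v₁} {p₂} {v₂} prime-p₀ p₀∤X₀ T≤p₀ block₁ block₂ crosses≡ =
      cong₂ _,_ p₁≡p₂ v₁≡v₂
      where
        open ≡-Reasoning
        instance _ = prime⇒nonZero prime-p₀
        factor : ∀ a b c → a * c - b * c ≡ (a - b) * c
        factor = solve-∀
        ΔX*p₀≡X₀*Δp : (X v₁ - X v₂) * + p₀ ≡ X v₀ * (+ p₁ - + p₂)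
        ΔX*p₀≡X₀*Δp = begin
          (X v₁ - X v₂) * + p₀            ≡⟨ factor (X v₁) (X v₂) (+ p₀) ⟨
          X v₁ * + p₀ - X v₂ * + p₀       ≡⟨ i-j≡k-l⇒i-k≡j-l (X v₁ * + p₀) (X v₀ * + p₁) (X v₂ * + p₀) (X v₀ * + p₂) crosses≡ ⟩
          X v₀ * + p₁ - X v₀ * + p₂       ≡⟨ trans (cong₂ _-_ (ℤ.*-comm (X v₀) (+ p₁)) (ℤ.*-comm (X v₀) (+ p₂))) (trans (factor (+ p₁) (+ p₂) (X v₀)) (ℤ.*-comm _ (X v₀))) ⟩
          X v₀ * (+ p₁ - + p₂)            ∎
        p₀∣X₀*Δp : p₀ ∣ℕ ∣ X v₀ ∣ ℕ.* ∣ p₁ ⊖ p₂ ∣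
        p₀∣X₀*Δp = divides ∣ X v₁ - X v₂ ∣ (begin
          ∣ X v₀ ∣ ℕ.* ∣ p₁ ⊖ p₂ ∣          ≡⟨ cong (λ z → ∣ X v₀ ∣ ℕ.* ∣ z ∣) (ℤ.m-n≡m⊖n p₁ p₂) ⟨
          ∣ X v₀ ∣ ℕ.* ∣ + p₁ - + p₂ ∣      ≡⟨ ℤ.abs-* (X v₀) (+ p₁ - + p₂) ⟨
          ∣ X v₀ * (+ p₁ - + p₂) ∣          ≡⟨ cong ∣_∣ ΔX*p₀≡X₀*Δp ⟨
          ∣ (X v₁ - X v₂) * + p₀ ∣          ≡⟨ ℤ.abs-* (X v₁ - X v₂) (+ p₀) ⟩
          ∣ X v₁ - X v₂ ∣ ℕ.* p₀            ∎)
        ∣p₁⊖p₂∣≡0 : ∣ p₁ ⊖ p₂ ∣ ≡ 0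
        ∣p₁⊖p₂∣≡0 with euclidsLemma ∣ X v₀ ∣ ∣ p₁ ⊖ p₂ ∣ prime-p₀ p₀∣X₀*Δp
        ... | inj₁ p₀∣X₀ = ⊥-elim (p₀∤X₀ p₀∣X₀)
        ... | inj₂ p₀∣Δp = small-multiple (ℕ.<-≤-trans (∣⊖∣<-InBlock block₁ block₂) T≤p₀) p₀∣Δp
          where
            small-multiple : ∀ {n} → n ℕ.< p₀ → p₀ ∣ℕ n → n ≡ 0
            small-multiple {zero} _ _ = refl
            small-multiple {suc _} n<p₀ p₀∣n = ⊥-elim (ℕ.<⇒≱ n<p₀ (ℕ.∣⇒≤ p₀∣n))
        p₁≡p₂ : p₁ ≡ p₂
        p₁≡p₂ = cong ∣_∣ (ℤ.i-j≡0⇒i≡j (+ p₁) (+ p₂) (trans (ℤ.m-n≡m⊖n p₁ p₂) (ℤ.∣i∣≡0⇒i≡0 ∣p₁⊖p₂∣≡0)))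
        X₁≡X₂ : X v₁ ≡ X v₂
        X₁≡X₂ = ℤ.*-cancelʳ-≡ (X v₁) (X v₂) (+ p₀) (∙-cancelʳ (- (X v₀ * + p₁)) (X v₁ * + p₀) (X v₂ * + p₀)
          (trans crosses≡ (cong (λ p → X v₂ * + p₀ - X v₀ * + p) (sym p₁≡p₂))))
        v₁≡v₂ : v₁ ≡ v₂
        v₁≡v₂ = cong ∣_∣ (ℤ.*-cancelˡ-≡ (+ 2 * A) (+ v₁) (+ v₂) (∙-cancelʳ B (+ 2 * A * + v₁) (+ 2 * A * + v₂) X₁≡X₂))

    IsRoot : ℕ × ℕ → Set
    IsRoot (p , v) = Prime p × p ℕ.* p ∣ℕ ∣ f v ∣

    isRoot? : Decidable IsRoot
    isRoot? (p , v) = prime? p ×-dec (p ℕ.* p ∣? ∣ f v ∣)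

    roots : ℕ → List (ℕ × ℕ)
    roots x = filter isRoot? (pairsUpTo x)

    large? : Decidable (λ (w : ℕ × ℕ) → P₀ ℕ.≤ proj₁ w)
    large? (p , _) = P₀ ≤? p

    W : ℕ
    W = (∣ D ∣ ℕ.+ ∣ D ∣) ℕ.+ (∣ D ∣ ℕ.+ ∣ D ∣)

    module _ (x : ℕ) where

      ∈-roots⁻ : ∀ {p v} → (p , v) ∈ roots x → (p ℕ.≤ x × v ℕ.< p) × IsRoot (p , v)
      ∈-roots⁻ w∈ = let w∈pairs , root = ∈-filter⁻ isRoot? {xs = pairsUpTo x} w∈ in ∈-pairsUpTo⁻ w∈pairs , root

      small-roots≤ : length (filter (¬? ∘ large?) (roots x)) ℕ.≤ P₀ ℕ.* P₀
      small-roots≤ = pigeonhole (P₀ ℕ.* P₀) code (Unique.filter⁺ (¬? ∘ large?) (Unique.filter⁺ isRoot? (pairsUpTo-unique x)))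
        code-injective code<
        where
          S = filter (¬? ∘ large?) (roots x)
          code : ℕ × ℕ → ℕ
          code (p , v) = v ℕ.+ p ℕ.* P₀
          small : ∀ {p v} → (p , v) ∈ S → v ℕ.< p × p ℕ.< P₀
          small w∈ = let w∈roots , ¬large = ∈-filter⁻ (¬? ∘ large?) {xs = roots x} w∈
                     in proj₂ (proj₁ (∈-roots⁻ w∈roots)) , ℕ.≰⇒> ¬large
          code< : ∀ {w} → w ∈ S → code w ℕ.< P₀ ℕ.* P₀
          code< {p , v} w∈ = let v<p , p<P₀ = small w∈ in
            ℕ.<-≤-trans (ℕ.+-monoˡ-< (p ℕ.* P₀) (ℕ.<-trans v<p p<P₀)) (ℕ.*-monoˡ-≤ P₀ p<P₀)
          code-injective : ∀ {w w′} → w ∈ S → w′ ∈ S → code w ≡ code w′ → w ≡ w′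
          code-injective {p , v} {p′ , v′} w∈ w′∈ codes≡ =
            let v<p , p<P₀ = small w∈
                v′<p′ , p′<P₀ = small w′∈
                v≡v′ , p≡p′ = +-*-injective P₀ (ℕ.<-trans v<p p<P₀) (ℕ.<-trans v′<p′ p′<P₀) codes≡
            in cong₂ _,_ p≡p′ v≡v′

      large-roots≤ : length (filter large? (roots x)) ℕ.≤ suc (ilog 2 x) ℕ.* K ℕ.* W
      large-roots≤ = length≤classes*width (suc (ilog 2 x) ℕ.* K) W {{W≢0}} class offset
        (Unique.filter⁺ large? (Unique.filter⁺ isRoot? (pairsUpTo-unique x))) class< offset< offset-injective
        where
          L = filter large? (roots x)
          W≢0 = ℕ.>-nonZero (ℕ.≤-trans 1≤∣D∣ (ℕ.≤-trans (ℕ.m≤m+n ∣ D ∣ ∣ D ∣) (ℕ.m≤m+n (∣ D ∣ ℕ.+ ∣ D ∣) (∣ D ∣ ℕ.+ ∣ D ∣))))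

          class : ℕ × ℕ → ℕ
          class (p , v) = (cofactor p v ℕ.∸ 1) ℕ.+ ilog 2 p ℕ.* K

          offset : ℕ × ℕ → ℕ × ℕ → ℕ
          offset (p₀ , v₀) (p , v) = ∣ cross (p , v) (p₀ , v₀) + + (∣ D ∣ ℕ.+ ∣ D ∣) ∣

          module _ {p v} (w∈ : (p , v) ∈ L) where
            private
              w∈roots = proj₁ (∈-filter⁻ large? {xs = roots x} w∈)
            P₀≤p : P₀ ℕ.≤ p
            P₀≤p = proj₂ (∈-filter⁻ large? {xs = roots x} w∈)
            p≤x : p ℕ.≤ x
            p≤x = proj₁ (proj₁ (∈-roots⁻ w∈roots))
            prime-p : Prime p
            prime-p = proj₁ (proj₂ (∈-roots⁻ w∈roots))
            1≤p : 1 ℕ.≤ p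
            1≤p = ℕ.≤-trans (s≤s z≤n) P₀≤p
            root : LargeRoot p v
            root = largeRoot P₀≤p (proj₂ (proj₁ (∈-roots⁻ w∈roots))) (proj₂ (proj₂ (∈-roots⁻ w∈roots)))
            cofactor-1<K : cofactor p v ℕ.∸ 1 ℕ.< K
            cofactor-1<K = ∸1< (LargeRoot.1≤cofactor root) (LargeRoot.cofactor≤K root)

          class< : ∀ {w} → w ∈ L → class w ℕ.< suc (ilog 2 x) ℕ.* K
          class< {p , v} w∈ = ℕ.<-≤-trans (ℕ.+-monoˡ-< (ilog 2 p ℕ.* K) (cofactor-1<K w∈))
            (ℕ.*-monoˡ-≤ K (s≤s (ilog-mono-≤ 2 (1≤p w∈) (p≤x w∈))))

          same-class : ∀ {p v p′ v′} → (p , v) ∈ L → (p′ , v′) ∈ L → class (p , v) ≡ class (p′ , v′) →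
            ilog 2 p ≡ ilog 2 p′ × cofactor p v ≡ cofactor p′ v′
          same-class {p} {v} {p′} {v′} w∈ w′∈ classes≡ =
            proj₂ decoded , pred-injective (LargeRoot.1≤cofactor (root w∈)) (LargeRoot.1≤cofactor (root w′∈)) (proj₁ decoded)
            where
              decoded = +-*-injective K (cofactor-1<K w∈) (cofactor-1<K w′∈) classes≡
              pred-injective : ∀ {a b} → 1 ℕ.≤ a → 1 ℕ.≤ b → a ℕ.∸ 1 ≡ b ℕ.∸ 1 → a ≡ b
              pred-injective {suc _} {suc _} _ _ = cong suc

          block-of : ∀ {p v} p′ → (p , v) ∈ L → ilog 2 p′ ≡ ilog 2 p → InBlock (2 ℕ.^ ilog 2 p′) p
          block-of _ w∈ logs≡ = subst (λ e → InBlock (2 ℕ.^ e) _) (sym logs≡) (InBlock-ilog (1≤p w∈))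

          ∣cross∣<2∣D∣-in-class : ∀ {r w} → r ∈ L → w ∈ L → class r ≡ class w → ∣ cross w r ∣ ℕ.< ∣ D ∣ ℕ.+ ∣ D ∣
          ∣cross∣<2∣D∣-in-class {_ , _} {p , _} r∈ w∈ r~w =
            ∣cross∣<2∣D∣ (root w∈) (root r∈) (sym (proj₂ same)) (block-of p w∈ refl) (block-of p r∈ (sym (proj₁ same)))
            where same = same-class r∈ w∈ r~w

          offset< : ∀ {r w} → r ∈ L → w ∈ L → class r ≡ class w → offset r w ℕ.< W
          offset< {r} {w} r∈ w∈ r~w = ℕ.≤-<-trans (ℤ.∣i+j∣≤∣i∣+∣j∣ (cross w r) (+ (∣ D ∣ ℕ.+ ∣ D ∣)))
            (ℕ.+-monoˡ-< (∣ D ∣ ℕ.+ ∣ D ∣) (∣cross∣<2∣D∣-in-class r∈ w∈ r~w))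

          offset-injective : ∀ {r w w′} → r ∈ L → w ∈ L → w′ ∈ L → class r ≡ class w → class r ≡ class w′ →
            offset r w ≡ offset r w′ → w ≡ w′
          offset-injective {r@(p₀ , v₀)} {w@(_ , v)} {w′@(_ , v′)} r∈ w∈ w′∈ r~w r~w′ offsets≡ =
            cross-injective {v₀ = v₀} {v₁ = v} {v₂ = v′} (prime-p r∈) (LargeRoot.p∤∣X∣ (root r∈)) (proj₁ (InBlock-ilog (1≤p r∈)))
              (block-of p₀ w∈ (proj₁ (same-class r∈ w∈ r~w))) (block-of p₀ w′∈ (proj₁ (same-class r∈ w′∈ r~w′)))
              (∙-cancelʳ (+ (∣ D ∣ ℕ.+ ∣ D ∣)) (cross w r) (cross w′ r)
                (trans (sym (unshift w∈ r~w)) (trans (cong +_ offsets≡) (unshift w′∈ r~w′))))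
            where
              unshift : ∀ {w} → w ∈ L → class r ≡ class w → + offset r w ≡ cross w r + + (∣ D ∣ ℕ.+ ∣ D ∣)
              unshift {w} w∈ r~w = +∣i+n∣≡i+n (cross w r) (ℕ.<⇒≤ (∣cross∣<2∣D∣-in-class r∈ w∈ r~w))

      roots≤ : length (roots x) ℕ.≤ P₀ ℕ.* P₀ ℕ.+ suc (ilog 2 x) ℕ.* (K ℕ.* W)
      roots≤ = begin
        length (roots x)                                                         ≡⟨ length-filter-split large? (roots x) ⟩
        length (filter large? (roots x)) ℕ.+ length (filter (¬? ∘ large?) (roots x)) ≤⟨ ℕ.+-mono-≤ large-roots≤ small-roots≤ ⟩
        suc (ilog 2 x) ℕ.* K ℕ.* W ℕ.+ P₀ ℕ.* P₀                                  ≡⟨ ℕ.+-comm _ (P₀ ℕ.* P₀) ⟩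
        P₀ ℕ.* P₀ ℕ.+ suc (ilog 2 x) ℕ.* K ℕ.* W                                  ≡⟨ cong (P₀ ℕ.* P₀ ℕ.+_) (ℕ.*-assoc (suc (ilog 2 x)) K W) ⟩
        P₀ ℕ.* P₀ ℕ.+ suc (ilog 2 x) ℕ.* (K ℕ.* W)                                ∎
        where open ℕ.≤-Reasoning

open import Defs
open import Data.Nat using (ℕ)
open import Data.Integer using (ℤ; +_; _≤_; _<_)
open import Data.Integer.GCD using (gcd)
open import Data.Product using (_×_)
open import Relation.Nullary using (¬_)
open import Relation.Binary.PropositionalEquality using (_≡_)

import Data.Nat as ℕ
import Data.Nat.Properties as ℕ
open import Data.Nat.Divisibility using (divides)
import Data.Integer as ℤ
import Data.Integer.Properties as ℤ
open import Data.Product using (_,_)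
open import Relation.Binary.PropositionalEquality using (trans; cong)
open PrimeCounting using (littleO-of-log)
open ListCounting using (length-filter-mono)
open QuadraticRoots using (module Roots)

lemma4p4 : (A B C : ℤ) (q : ℤ) (m : ℕ) →
    + 0 < A → gcd (gcd A B) C ≡ + 1 → ¬ IsSquare (disc A B C) →
    InfManyGoodPrimes (disc A B C) q m →
    ((a : ℤ) → + 1 ≤ a → a ≤ A → LittleOPi (Sa A B C q m a))
    × LittleOPi (SY A B C q m)
lemma4p4 (+ 0) _ _ _ _ (ℤ.+<+ ()) _ _ _
lemma4p4 ℤ.-[1+ _ ] _ _ _ _ () _ _ _
lemma4p4 A@(+ ℕ.suc A₀) B C q m _ _ D-nonsquare _ =
  (λ a _ _ → littleO-of-log (Sa A B C q m a) c₁ c₂ λ x →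
    ℕ.≤-trans (length-filter-mono (inYa? A B C q m a) isRoot? (λ {w} → Ya⇒root {a} {w}) (pairsUpTo x)) (roots≤ x)) ,
  littleO-of-log (SY A B C q m) c₁ c₂ λ x →
    ℕ.≤-trans (length-filter-mono (inY? A B C q m) isRoot? (λ {w} → Y⇒root {w}) (pairsUpTo x)) (roots≤ x)
  where
    open Roots A₀ B C D-nonsquare using (P₀; K; W; IsRoot; isRoot?; roots≤)
    c₁ = P₀ ℕ.* P₀
    c₂ = K ℕ.* W
    Ya⇒root : ∀ {a w} → InYa A B C q m a w → IsRoot w
    Ya⇒root {a} {p , _} (prime-p , _ , f≡ap²) = prime-p , divides ℤ.∣ a ∣ (trans (cong ℤ.∣_∣ f≡ap²) (ℤ.abs-* a (+ (p ℕ.* p))))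
    Y⇒root : ∀ {w} → InY A B C q m w → IsRoot w
    Y⇒root (prime-p , _ , p²∣f) = prime-p , p²∣f
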